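{- For all integers $k,n\ge 0$, $u_{2k}(n+1)\ge u_{2k}(n)$, where $u_{2k}(n):=\sum_{m\in\mathbb Z}m^{2k}u(m,n)$.
   Context: A strongly unimodal sequence of size $n$ is a finite sequence of positive integers $\{a_j\}_{j=1}^s$ with $a_1<\dots<a_k>\dots>a_s$ for some $k$ and $\sum a_j=n$; its rank is $s-2k+1$; $u(m,n)$ is the number of such sequences of size $n$ and rank $m$ (for $n=0$ all $u(m,0)=0$). Here $0^0=1$. -}

module Defs where

open import Data.Nat as ℕ using (ℕ; zero; suc; _≤_; _<_; _>_; _∸_)
import Data.Nat.Properties as ℕP
open import Data.Integer as ℤ using (ℤ; +_)
import Data.Integer.Properties as ℤP
open import Data.List using (List; []; _∷_; length; take; drop; upTo; map; concatMap; filter; foldr)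
open import Data.Nat.ListAction using (sum)
open import Data.List.Relation.Unary.Linked using (Linked; linked?)
open import Data.List.Relation.Unary.All using (All; all?)
open import Data.List.Relation.Unary.Any using (Any; any?)
open import Data.Product using (_×_)
open import Relation.Binary.PropositionalEquality using (_≡_)
open import Relation.Nullary using (Dec)
open import Relation.Nullary.Decidable using (_×-dec_)

rank : List ℕ → ℕ → ℤ
rank a k = (+ length a ℤ.- (+ 2 ℤ.* + k)) ℤ.+ + 1

UnimodalAt : List ℕ → ℕ → Set
UnimodalAt a k =
  (1 ≤ k) × (k ≤ length a) × Linked _<_ (take k a) × Linked _>_ (drop (k ∸ 1) a)

unimodalAt? : ∀ a k → Dec (UnimodalAt a k)
unimodalAt? a k =
  (1 ℕ.≤? k) ×-dec ((k ℕ.≤? length a) ×-dec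
    (linked? ℕ._<?_ (take k a) ×-dec linked? ℕ._>?_ (drop (k ∸ 1) a)))

-- a is a strongly unimodal sequence of size n and rank m:
-- all entries positive, sum n, and there is k with a_1<...<a_k>...>a_s
-- and s - 2k + 1 = m.  (k necessarily lies in 1..s, so ranging over
-- 0..s is no restriction.)
SUSeq : ℤ → ℕ → List ℕ → Set
SUSeq m n a =
  All (1 ≤_) a × (sum a ≡ n) ×
  Any (λ k → UnimodalAt a k × (rank a k ≡ m)) (upTo (suc (length a)))

SUSeq? : ∀ m n a → Dec (SUSeq m n a)
SUSeq? m n a =
  all? (1 ℕ.≤?_) a ×-dec ((sum a ℕ.≟ n) ×-dec
    any? (λ k → unimodalAt? a k ×-dec (rank a k ℤ.≟ m)) (upTo (suc (length a))))

listsOfLen : ℕ → ℕ → List (List ℕ)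
listsOfLen zero    n = [] ∷ []
listsOfLen (suc L) n =
  concatMap (λ x → map (x ∷_) (listsOfLen L n)) (map suc (upTo n))

-- Candidate sequences for size n: all lists of length ≤ n with entries
-- in {1,...,n}; every sequence of positive integers with sum n is among
-- them, exactly once.
candidates : ℕ → List (List ℕ)
candidates n = concatMap (λ L → listsOfLen L n) (upTo (suc n))

-- u(m,n): the number of strongly unimodal sequences of size n and rank m.
-- (For n = 0 this gives 0, matching the convention u(m,0) = 0.)
u : ℤ → ℕ → ℕ
u m n = length (filter (SUSeq? m n) (candidates n))

sumℤ : List ℤ → ℤ
sumℤ = foldr ℤ._+_ (+ 0)

range± : ℕ → List ℤ
range± n = map (λ i → + i ℤ.- + n) (upTo (suc (2 ℕ.* n)))

-- Since every strongly unimodal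
-- sequence of size n has length s ≤ n and 1 ≤ k ≤ s, its rank satisfies
-- |m| ≤ n, so u(m,n) = 0 for |m| > n and the sum may be taken over
-- -n ≤ m ≤ n.  (ℤ exponentiation has 0^0 = 1.)
u2k : ℕ → ℕ → ℤ
u2k k n = sumℤ (map (λ m → (m ℤ.^ (2 ℕ.* k)) ℤ.* + u m n) (range± n))

module Submission where

-- The "peak bump" a ↦ bump a adds 1 to the peak of a strongly
-- unimodal sequence.  It keeps the length, the peak position (hence the
-- rank) and the strong unimodality, raises the size by exactly 1, and it is
-- injective (it has an explicit left inverse `unbump`).  Since `u m n` counts
-- a duplicate-free enumeration `candidates n` filtered by the defining
-- predicate, an injection between the filtered lists gives
--   u(m,n) ≤ u(m,n+1)   for every rank m.
-- Finally u_{2k}(n) = Σ_{|m|≤n} m^{2k} u(m,n) has non-negative weights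
-- m^{2k}, so termwise monotonicity plus the two extra non-negative terms
-- m = ±(n+1) of u_{2k}(n+1) yield u_{2k}(n) ≤ u_{2k}(n+1).

open import Defs
open import Data.Nat as ℕ using (ℕ; zero; suc; _≤_; _<_; _>_; z≤n; s≤s; _<?_; pred)
import Data.Nat.Properties as ℕP
open import Data.Integer as ℤ using (ℤ; +_; -[1+_]; +≤+)
import Data.Integer.Properties as ℤP
open import Data.List using (List; []; _∷_; length; upTo; applyUpTo; map; concatMap; filter)
open import Data.List.Properties using (length-map; ∷-injectiveʳ; map-∘; map-upTo)
open import Data.Nat.ListAction using (sum)
open import Data.List.Relation.Unary.Linked using (Linked; [-]; _∷_)
import Data.List.Relation.Unary.Linked as Linked
open import Data.List.Relation.Unary.All as All using (All; []; _∷_)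
open import Data.List.Relation.Unary.Any as Any using (Any; here; there)
open import Data.List.Relation.Unary.AllPairs using ([]; _∷_)
open import Data.List.Relation.Unary.Unique.Propositional using (Unique)
import Data.List.Relation.Unary.Unique.Propositional.Properties as Unique
open import Data.List.Membership.Propositional using (_∈_; lose)
open import Data.List.Membership.Propositional.Properties
open import Data.Product using (_×_; _,_; ∃₂)
open import Data.Empty using (⊥; ⊥-elim)
open import Function using (_∘_)
open import Function.Definitions using (Injective)
open import Relation.Binary.PropositionalEquality
open import Relation.Nullary using (¬_; yes; no)

module _ {A : Set} where

  remove : ∀ {x : A} {ys} → x ∈ ys → List A
  remove {ys = _ ∷ ys} (here _)  = ys
  remove {ys = y ∷ _}  (there p) = y ∷ remove p

  length-remove : ∀ {x : A} {ys} (p : x ∈ ys) → suc (length (remove p)) ≡ length ys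
  length-remove (here _)  = refl
  length-remove (there p) = cong suc (length-remove p)

  ∈-remove : ∀ {x z : A} {ys} (p : x ∈ ys) → z ∈ ys → z ≢ x → z ∈ remove p
  ∈-remove (here refl) (here refl) z≢x = ⊥-elim (z≢x refl)
  ∈-remove (here _)    (there q)   _   = q
  ∈-remove (there p)   (here z≡y)  _   = here z≡y
  ∈-remove (there p)   (there q)   z≢x = there (∈-remove p q z≢x)

  unique⊆⇒length≤ : ∀ {xs ys : List A} → Unique xs → (∀ {x} → x ∈ xs → x ∈ ys) →
                    length xs ≤ length ys
  unique⊆⇒length≤ {[]}     _                _   = z≤n
  unique⊆⇒length≤ {x ∷ xs} (x∉xs ∷ unique) xs⊆ys =
    subst (_ ≤_) (length-remove x∈ys)
      (s≤s (unique⊆⇒length≤ unique λ z∈xs →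
        ∈-remove x∈ys (xs⊆ys (there z∈xs)) λ z≡x → All.lookup x∉xs z∈xs (sym z≡x)))
    where x∈ys = xs⊆ys (here refl)

injection⇒length≤ : ∀ {A B : Set} (f : A → B) → Injective _≡_ _≡_ f →
                    {xs : List A} {ys : List B} → Unique xs →
                    (∀ {x} → x ∈ xs → f x ∈ ys) → length xs ≤ length ys
injection⇒length≤ f f-inj {xs} unique maps-into =
  subst (_≤ _) (length-map f xs) (unique⊆⇒length≤ (Unique.map⁺ f-inj unique) image⊆)
  where
    image⊆ : ∀ {y} → y ∈ map f xs → y ∈ _
    image⊆ y∈ with ∈-map⁻ f y∈
    ... | _ , x∈xs , refl = maps-into x∈xs

unique-concatMap : ∀ {A B : Set} (g : B → A) (f : A → List B) {is : List A} →
                   Unique is → (∀ i → Unique (f i)) → (∀ i {y} → y ∈ f i → g y ≡ i) →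
                   Unique (concatMap f is)
unique-concatMap g f {[]}     _               _        _     = []
unique-concatMap g f {i ∷ is} (i∉is ∷ unique) blocks labelled =
  Unique.++⁺ (blocks i) (unique-concatMap g f unique blocks labelled) disjoint
  where
    notInLater : ∀ {y js} → y ∈ f i → All (i ≢_) js → Any (λ j → y ∈ f j) js → ⊥
    notInLater y∈ (i≢j ∷ _) (here y∈′)  = i≢j (trans (sym (labelled i y∈)) (labelled _ y∈′))
    notInLater y∈ (_ ∷ i∉) (there y∈′) = notInLater y∈ i∉ y∈′

    disjoint : ∀ {y} → ¬ (y ∈ f i × y ∈ concatMap f is)
    disjoint (y∈ , y∈rest) = notInLater y∈ i∉is (∈-concatMap⁻ f {xs = is} y∈rest)

-- The first entry of a list; it identifies the block of listsOfLen (suc L) n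
-- containing the list.
head₀ : List ℕ → ℕ
head₀ []      = 0
head₀ (x ∷ _) = x

startingWith : ℕ → ℕ → ℕ → List (List ℕ)
startingWith L n x = map (x ∷_) (listsOfLen L n)

listsOfLen-length : ∀ L n {a} → a ∈ listsOfLen L n → length a ≡ L
listsOfLen-length zero    n (here refl) = refl
listsOfLen-length (suc L) n a∈
  with _ , a∈block ← Any.satisfied (∈-concatMap⁻ (startingWith L n) {xs = map suc (upTo n)} a∈)
  with _ , b∈ , refl ← ∈-map⁻ _ a∈block
  = cong suc (listsOfLen-length L n b∈)

listsOfLen-unique : ∀ L n → Unique (listsOfLen L n)
listsOfLen-unique zero    n = [] ∷ []
listsOfLen-unique (suc L) n =
  unique-concatMap head₀ (startingWith L n)
    (Unique.map⁺ ℕP.suc-injective (Unique.upTo⁺ n))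
    (λ _ → Unique.map⁺ ∷-injectiveʳ (listsOfLen-unique L n))
    headOfBlock
  where
    headOfBlock : ∀ x {a} → a ∈ startingWith L n x → head₀ a ≡ x
    headOfBlock x a∈ with _ , _ , refl ← ∈-map⁻ _ a∈ = refl

candidates-unique : ∀ n → Unique (candidates n)
candidates-unique n =
  unique-concatMap length (λ L → listsOfLen L n) (Unique.upTo⁺ (suc n))
    (λ L → listsOfLen-unique L n) (λ L → listsOfLen-length L n)

listsOfLen-complete : ∀ N a → All (λ x → 1 ≤ x × x ≤ N) a → a ∈ listsOfLen (length a) N
listsOfLen-complete N []          []                  = here refl
listsOfLen-complete N (suc x ∷ r) ((_ , x<N) ∷ bounds) =
  ∈-concatMap⁺ (startingWith (length r) N) {xs = map suc (upTo N)}
    (lose (∈-map⁺ suc (∈-upTo⁺ x<N)) (∈-map⁺ (suc x ∷_) (listsOfLen-complete N r bounds)))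

entries≤sum : ∀ a → All (_≤ sum a) a
entries≤sum []      = []
entries≤sum (x ∷ r) =
  ℕP.m≤m+n x (sum r) ∷ All.map (λ x≤ → ℕP.≤-trans x≤ (ℕP.m≤n+m (sum r) x)) (entries≤sum r)

length≤sum : ∀ a → All (1 ≤_) a → length a ≤ sum a
length≤sum []      []         = z≤n
length≤sum (x ∷ r) (1≤x ∷ ps) = ℕP.+-mono-≤ 1≤x (length≤sum r ps)

candidates-complete : ∀ N a → All (1 ≤_) a → sum a ≡ N → a ∈ candidates N
candidates-complete _ a positive refl =
  ∈-concatMap⁺ (λ L → listsOfLen L (sum a)) {xs = upTo (suc (sum a))}
    (lose (∈-upTo⁺ (s≤s (length≤sum a positive)))
      (listsOfLen-complete (sum a) a (All.zip (positive , entries≤sum a))))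

-- bumpFrom x r increments the first entry of x ∷ r that exceeds its
-- successor (the last entry if there is none); on a strongly unimodal
-- sequence this is the peak.
bumpFrom : ℕ → List ℕ → List ℕ
bumpFrom x []      = suc x ∷ []
bumpFrom x (y ∷ r) with y <? x
... | yes _ = suc x ∷ y ∷ r
... | no _  = x ∷ bumpFrom y r

bump : List ℕ → List ℕ
bump []      = []
bump (x ∷ r) = bumpFrom x r

unbumpFrom : ℕ → List ℕ → List ℕ
unbumpFrom x []      = pred x ∷ []
unbumpFrom x (y ∷ r) with y <? x
... | yes _ = pred x ∷ y ∷ r
... | no _  = x ∷ unbumpFrom y r

unbump : List ℕ → List ℕ
unbump []      = []
unbump (x ∷ r) = unbumpFrom x r

bump-head : ∀ y r → ∃₂ λ h t → bump (y ∷ r) ≡ h ∷ t × y ≤ h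
bump-head y []      = _ , _ , refl , ℕP.n≤1+n y
bump-head y (z ∷ r) with z <? y
... | yes _ = _ , _ , refl , ℕP.n≤1+n y
... | no _  = _ , _ , refl , ℕP.≤-refl

unbump-skip : ∀ x h t → ¬ h < x → unbump (x ∷ h ∷ t) ≡ x ∷ unbump (h ∷ t)
unbump-skip x h t h≮x with h <? x
... | yes h<x = ⊥-elim (h≮x h<x)
... | no _    = refl

unbump-bump-∷ : ∀ x r → unbump (bump (x ∷ r)) ≡ x ∷ r
unbump-bump-∷ x []      = refl
unbump-bump-∷ x (y ∷ r) with y <? x
... | yes y<x with y <? suc x
...   | yes _     = refl
...   | no y≮1+x  = ⊥-elim (y≮1+x (ℕP.m<n⇒m<1+n y<x))
unbump-bump-∷ x (y ∷ r) | no y≮x with bump-head y r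
... | h , t , bumped , y≤h = begin
  unbump (x ∷ bump (y ∷ r))  ≡⟨ cong (unbump ∘ (x ∷_)) bumped ⟩
  unbump (x ∷ h ∷ t)         ≡⟨ unbump-skip x h t (λ h<x → y≮x (ℕP.≤-<-trans y≤h h<x)) ⟩
  x ∷ unbump (h ∷ t)         ≡⟨ cong (λ l → x ∷ unbump l) (sym bumped) ⟩
  x ∷ unbump (bump (y ∷ r))  ≡⟨ cong (x ∷_) (unbump-bump-∷ y r) ⟩
  x ∷ y ∷ r                  ∎
  where open ≡-Reasoning

unbump-bump : ∀ a → unbump (bump a) ≡ a
unbump-bump []      = refl
unbump-bump (x ∷ r) = unbump-bump-∷ x r

bump-injective : Injective _≡_ _≡_ bump
bump-injective {a} {b} eq = begin
  a                 ≡⟨ sym (unbump-bump a) ⟩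
  unbump (bump a)   ≡⟨ cong unbump eq ⟩
  unbump (bump b)   ≡⟨ unbump-bump b ⟩
  b                 ∎
  where open ≡-Reasoning

length-bump : ∀ x r → length (bump (x ∷ r)) ≡ length (x ∷ r)
length-bump x []      = refl
length-bump x (y ∷ r) with y <? x
... | yes _ = refl
... | no _  = cong suc (length-bump y r)

sum-bump : ∀ x r → sum (bump (x ∷ r)) ≡ suc (sum (x ∷ r))
sum-bump x []      = refl
sum-bump x (y ∷ r) with y <? x
... | yes _ = refl
... | no _  = trans (cong (x ℕ.+_) (sum-bump y r)) (ℕP.+-suc x _)

positive-bump : ∀ {x r} → All (1 ≤_) (x ∷ r) → All (1 ≤_) (bump (x ∷ r))
positive-bump {x} {[]}    _          = s≤s z≤n ∷ []
positive-bump {x} {y ∷ r} (1≤x ∷ ps) with y <? x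
... | yes _ = s≤s z≤n ∷ ps
... | no _  = 1≤x ∷ positive-bump ps

unimodalAt-first : ∀ {x r} → Linked _>_ (x ∷ r) → UnimodalAt (x ∷ r) 1
unimodalAt-first decreasing = s≤s z≤n , s≤s z≤n , [-] , decreasing

unimodalAt-ascent⁻ : ∀ {x y r i} → UnimodalAt (x ∷ y ∷ r) (suc (suc i)) →
                     x < y × UnimodalAt (y ∷ r) (suc i)
unimodalAt-ascent⁻ (_ , s≤s i<len , ascending , descending) =
  Linked.head ascending , (s≤s z≤n , i<len , Linked.tail ascending , descending)

unimodalAt-ascent⁺ : ∀ {x y r i} → x < y → UnimodalAt (y ∷ r) (suc i) →
                     UnimodalAt (x ∷ y ∷ r) (suc (suc i))
unimodalAt-ascent⁺ x<y (_ , i<len , ascending , descending) =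
  s≤s z≤n , s≤s i<len , x<y ∷ ascending , descending

unimodal-bump : ∀ x r k → UnimodalAt (x ∷ r) k → UnimodalAt (bump (x ∷ r)) k
unimodal-bump x []      zero          (() , _)
unimodal-bump x []      (suc zero)    _ = unimodalAt-first [-]
unimodal-bump x []      (suc (suc i)) (_ , s≤s () , _)
unimodal-bump x (y ∷ r) zero          (() , _)
unimodal-bump x (y ∷ r) (suc zero)    (_ , _ , _ , y<x ∷ descending) with y <? x
... | yes _   = unimodalAt-first (ℕP.m<n⇒m<1+n y<x ∷ descending)
... | no y≮x  = ⊥-elim (y≮x y<x)
unimodal-bump x (y ∷ r) (suc (suc i)) peaked with unimodalAt-ascent⁻ peaked
... | x<y , peakedAfter with y <? x
...   | yes y<x = ⊥-elim (ℕP.<-asym x<y y<x)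
...   | no _ with bump (y ∷ r) | bump-head y r | unimodal-bump y r (suc i) peakedAfter
...     | _ | h , t , refl , y≤h | bumpedPeaked = unimodalAt-ascent⁺ (ℕP.<-≤-trans x<y y≤h) bumpedPeaked

rank-cong : ∀ {a b} k → length a ≡ length b → rank a k ≡ rank b k
rank-cong k eq = cong (λ L → (+ L ℤ.- (+ 2 ℤ.* + k)) ℤ.+ + 1) eq

SUSeq-bump : ∀ {m n} a → SUSeq m n a → SUSeq m (suc n) (bump a)
SUSeq-bump []      (_ , _ , here ((() , _) , _))
SUSeq-bump []      (_ , _ , there ())
SUSeq-bump {m} (x ∷ r) (positive , summed , peaks) =
  positive-bump positive ,
  trans (sum-bump x r) (cong suc summed) ,
  subst (λ L → Any (peakWithRank (bump (x ∷ r))) (upTo (suc L)))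
        (sym (length-bump x r))
        (Any.map (λ {k} (peaked , ranked) →
                   unimodal-bump x r k peaked ,
                   trans (rank-cong {bump (x ∷ r)} {x ∷ r} k (length-bump x r)) ranked)
                 peaks)
  where
    peakWithRank : List ℕ → ℕ → Set
    peakWithRank b k = UnimodalAt b k × (rank b k ≡ m)

u-mono : ∀ m n → u m n ≤ u m (suc n)
u-mono m n =
  injection⇒length≤ bump bump-injective
    (Unique.filter⁺ (SUSeq? m n) (candidates-unique n)) bumped∈
  where
    bumped∈ : ∀ {a} → a ∈ filter (SUSeq? m n) (candidates n) →
              bump a ∈ filter (SUSeq? m (suc n)) (candidates (suc n))
    bumped∈ {a} a∈ with _ , isSeq ← ∈-filter⁻ (SUSeq? m n) {xs = candidates n} a∈
      with bumpedSeq@(positive , summed , _) ← SUSeq-bump a isSeq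
      = ∈-filter⁺ (SUSeq? m (suc n)) (candidates-complete (suc n) (bump a) positive summed) bumpedSeq

sumUpTo : ℕ → (ℕ → ℤ) → ℤ
sumUpTo N f = sumℤ (applyUpTo f N)

sumUpTo-mono : ∀ N {f g : ℕ → ℤ} → (∀ i → f i ℤ.≤ g i) → sumUpTo N f ℤ.≤ sumUpTo N g
sumUpTo-mono zero    f≤g = ℤP.≤-refl
sumUpTo-mono (suc N) f≤g = ℤP.+-mono-≤ (f≤g 0) (sumUpTo-mono N (f≤g ∘ suc))

sumUpTo-extend : ∀ N (g : ℕ → ℤ) → (∀ i → + 0 ℤ.≤ g i) → sumUpTo N g ℤ.≤ sumUpTo (suc N) g
sumUpTo-extend zero    g g≥0 = ℤP.i≤j+i (+ 0) (g 0) {{ℤ.nonNegative (g≥0 0)}}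
sumUpTo-extend (suc N) g g≥0 = ℤP.+-monoʳ-≤ (g 0) (sumUpTo-extend N (g ∘ suc) (g≥0 ∘ suc))

sumUpTo-shift-mono : ∀ N (f g : ℕ → ℤ) → (∀ i → + 0 ℤ.≤ g i) → (∀ i → f i ℤ.≤ g (suc i)) →
                     sumUpTo N f ℤ.≤ sumUpTo (suc (suc N)) g
sumUpTo-shift-mono N f g g≥0 f≤g′ = begin
  sumUpTo N f                      ≤⟨ sumUpTo-mono N f≤g′ ⟩
  sumUpTo N (g ∘ suc)              ≤⟨ sumUpTo-extend N (g ∘ suc) (g≥0 ∘ suc) ⟩
  sumUpTo (suc N) (g ∘ suc)        ≤⟨ ℤP.i≤j+i _ (g 0) {{ℤ.nonNegative (g≥0 0)}} ⟩
  g 0 ℤ.+ sumUpTo (suc N) (g ∘ suc) ∎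
  where open ℤP.≤-Reasoning

*-nonneg : ∀ {i j} → + 0 ℤ.≤ i → + 0 ℤ.≤ j → + 0 ℤ.≤ i ℤ.* j
*-nonneg {+ a} {+ b} _ _ = subst (+ 0 ℤ.≤_) (ℤP.pos-* a b) (+≤+ z≤n)

^-nonneg : ∀ i k → + 0 ℤ.≤ i → + 0 ℤ.≤ i ℤ.^ k
^-nonneg i zero    _   = +≤+ z≤n
^-nonneg i (suc k) i≥0 = *-nonneg i≥0 (^-nonneg i k i≥0)

square-nonneg : ∀ m → + 0 ℤ.≤ m ℤ.* m
square-nonneg (+ a)    = subst (+ 0 ℤ.≤_) (ℤP.pos-* a a) (+≤+ z≤n)
square-nonneg -[1+ a ] = +≤+ z≤n

-- m^{2k} = (m·m)^k ≥ 0.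
even-power-nonneg : ∀ m k → + 0 ℤ.≤ m ℤ.^ (2 ℕ.* k)
even-power-nonneg m k = subst (+ 0 ℤ.≤_) (ℤP.^-*-assoc m 2 k)
  (^-nonneg (m ℤ.^ 2) k (subst (λ j → + 0 ℤ.≤ m ℤ.* j) (sym (ℤP.*-identityʳ m)) (square-nonneg m)))

weighted : ℕ → ℕ → ℤ → ℤ
weighted k n m = (m ℤ.^ (2 ℕ.* k)) ℤ.* + u m n

weighted-nonneg : ∀ k n m → + 0 ℤ.≤ weighted k n m
weighted-nonneg k n m = *-nonneg (even-power-nonneg m k) (+≤+ z≤n)

weighted-mono : ∀ k n m → weighted k n m ℤ.≤ weighted k (suc n) m
weighted-mono k n m =
  ℤP.*-monoˡ-≤-nonNeg (m ℤ.^ (2 ℕ.* k)) {{ℤ.nonNegative (even-power-nonneg m k)}}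
    (+≤+ (u-mono m n))

u2k-as-sumUpTo : ∀ k n → u2k k n ≡ sumUpTo (suc (2 ℕ.* n)) (λ i → weighted k n (+ i ℤ.- + n))
u2k-as-sumUpTo k n = cong sumℤ (begin
  map (weighted k n) (range± n)                                 ≡⟨ map-∘ (upTo (suc (2 ℕ.* n))) ⟨
  map (λ i → weighted k n (+ i ℤ.- + n)) (upTo (suc (2 ℕ.* n)))  ≡⟨ map-upTo _ (suc (2 ℕ.* n)) ⟩
  applyUpTo (λ i → weighted k n (+ i ℤ.- + n)) (suc (2 ℕ.* n))   ∎)
  where open ≡-Reasoning

-- Index i+1 for size n+1 is the rank that index i denotes for size n.
rank-shift : ∀ i n → + suc i ℤ.- + suc n ≡ + i ℤ.- + n
rank-shift i n = begin
  + suc i ℤ.- + suc n  ≡⟨ ℤP.m-n≡m⊖n (suc i) (suc n) ⟩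
  suc i ℤ.⊖ suc n      ≡⟨ ℤP.[1+m]⊖[1+n]≡m⊖n i n ⟩
  i ℤ.⊖ n              ≡⟨ ℤP.m-n≡m⊖n i n ⟨
  + i ℤ.- + n          ∎
  where open ≡-Reasoning

proposition4p2 : (k n : ℕ) → u2k k n ℤ.≤ u2k k (suc n)
proposition4p2 k n = begin
  u2k k n                                ≡⟨ u2k-as-sumUpTo k n ⟩
  sumUpTo (suc (2 ℕ.* n)) atSize         ≤⟨ sumUpTo-shift-mono (suc (2 ℕ.* n)) atSize atNextSize
                                              (λ _ → weighted-nonneg k (suc n) _) dominated ⟩
  sumUpTo (suc (suc (suc (2 ℕ.* n)))) atNextSize
                                         ≡⟨ cong (λ N → sumUpTo (suc N) atNextSize) (ℕP.*-suc 2 n) ⟨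
  sumUpTo (suc (2 ℕ.* suc n)) atNextSize ≡⟨ u2k-as-sumUpTo k (suc n) ⟨
  u2k k (suc n)                          ∎
  where
    open ℤP.≤-Reasoning
    atSize atNextSize : ℕ → ℤ
    atSize i     = weighted k n (+ i ℤ.- + n)
    atNextSize i = weighted k (suc n) (+ i ℤ.- + suc n)

    dominated : ∀ i → atSize i ℤ.≤ atNextSize (suc i)
    dominated i = subst (atSize i ℤ.≤_) (cong (weighted k (suc n)) (sym (rank-shift i n)))
                        (weighted-mono k n _)
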